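{- Let $\lambda\in\mathbb{C}_p$ with $\lambda\ne0$ and $|\lambda|_p\le1$ ($p$ an odd prime). For every $n\ge0$, \[ Ch_{n,\lambda}(x)=\sum_{k=0}^n\sum_{m=0}^k\binom{n}{k}(x)_{m,\lambda}\,S_1(k,m)\,Ch_{n-k,\lambda}. \]
   Context: $(x)_{0,\lambda}=1$, $(x)_{n,\lambda}=x(x-\lambda)\cdots(x-(n-1)\lambda)$ for $n\ge1$, and $(1+\lambda u)^{x/\lambda}=\sum_{m\ge0}(x)_{m,\lambda}u^m/m!$. $S_1(k,m)$ are the signed Stirling numbers of the first kind: $x(x-1)\cdots(x-k+1)=\sum_{m=0}^kS_1(k,m)x^m$. The degenerate Changhee polynomials of the second kind are defined by $\frac{2}{1+(1+\lambda\log(1+t))^{1/\lambda}}(1+\lambda\log(1+t))^{x/\lambda}=\sum_{n\ge0}Ch_{n,\lambda}(x)\frac{t^n}{n!}$, and $Ch_{n,\lambda}=Ch_{n,\lambda}(0)$ are the degenerate Changhee numbers of the second kind. -}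

module Defs where

open import Level using (Level)
open import Algebra.Bundles using (CommutativeRing)
open import Data.Nat using (ℕ; zero; suc; _∸_)
open import Data.Nat.Combinatorics using (_C_)

-- All objects live in an arbitrary commutative ring R (the paper: R = ℂ_p).
-- Formal power series are represented in exponential form: a sequence
-- a : ℕ → Carrier stands for  Σ_n a n t^n / n!.
module Changhee {c ℓ : Level} (R : CommutativeRing c ℓ) where
  open CommutativeRing R hiding (zero)

  natR : ℕ → Carrier
  natR zero    = 0#
  natR (suc n) = 1# + natR n

  sumTo : (ℕ → Carrier) → ℕ → Carrier
  sumTo f zero    = f zero
  sumTo f (suc n) = sumTo f n + f (suc n)

  -- product of exponential generating functions:
  -- (Σ a_n t^n/n!)(Σ b_n t^n/n!) = Σ (Σ_k C(n,k) a_k b_{n-k}) t^n/n!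
  _⊛_ : (ℕ → Carrier) → (ℕ → Carrier) → ℕ → Carrier
  (a ⊛ b) n = sumTo (λ k → natR (n C k) * (a k * b (n ∸ k))) n

  -- log(1+t) = Σ_{n≥1} (-1)^{n-1} (n-1)! t^n/n!
  logSeries : ℕ → Carrier
  logSeries zero                = 0#
  logSeries (suc zero)          = 1#
  logSeries (suc (suc n))       = - (natR (suc n) * logSeries (suc n))

  -- divided powers u^m/m! of a series u with u 0 = 0, determined by
  -- (u^0/0!) = 1, (u^m/m!)(0) = 0 for m ≥ 1, and
  -- d/dt (u^{m+1}/(m+1)!) = u' · u^m/m!  (derivative = index shift in EGF form)
  divPow : (ℕ → Carrier) → ℕ → ℕ → Carrier
  divPow u zero    zero    = 1#
  divPow u zero    (suc n) = 0#
  divPow u (suc m) zero    = 0#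
  divPow u (suc m) (suc n) = ((λ k → u (suc k)) ⊛ divPow u m) n

  fallD : Carrier → Carrier → ℕ → Carrier
  fallD lam x zero    = 1#
  fallD lam x (suc m) = fallD lam x m * (x - natR m * lam)

  -- (1 + λ log(1+t))^{x/λ} = Σ_m (x)_{m,λ} (log(1+t))^m / m!
  -- (the coefficient of t^n/n! only receives contributions from m ≤ n)
  degPowLog : Carrier → Carrier → ℕ → Carrier
  degPowLog lam x n = sumTo (λ m → fallD lam x m * divPow logSeries m n) n

  -- 1 + (1 + λ log(1+t))^{1/λ}
  denom : Carrier → ℕ → Carrier
  denom lam zero    = 1# + degPowLog lam 1# zero
  denom lam (suc n) = degPowLog lam 1# (suc n)

  -- Ch : x ↦ (n ↦ Ch_{n,λ}(x)) are the degenerate Changhee polynomials of the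
  -- second kind iff  (1 + (1+λlog(1+t))^{1/λ}) · Σ Ch_{n,λ}(x) t^n/n!
  --                  = 2 (1+λlog(1+t))^{x/λ}
  -- (equivalent to the defining generating function since 2 is invertible).
  IsChanghee2 : Carrier → (Carrier → ℕ → Carrier) → Set (c Level.⊔ ℓ)
  IsChanghee2 lam Ch =
    ∀ x n → (denom lam ⊛ Ch x) n ≈ (1# + 1#) * degPowLog lam x n

  -- signed Stirling numbers of the first kind:
  -- x(x-1)…(x-k+1) = Σ_m S₁(k,m) x^m
  S₁ : ℕ → ℕ → Carrier
  S₁ zero    zero    = 1#
  S₁ zero    (suc m) = 0#
  S₁ (suc k) zero    = 0#
  S₁ (suc k) (suc m) = S₁ k m - natR k * S₁ k (suc m)

module Submission where

-- We work with exponential generating functions over an arbitrary commutative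
-- ring: a sequence a stands for Σ a_n tⁿ/n!, the product of series is the
-- binomial convolution ⊛, and d/dt is the index shift ∂.  The proof has three
-- ingredients.
--  * The series ring: ∂ is a derivation of ⊛ (Leibniz rule); from this,
--    commutativity and associativity of ⊛ follow by induction on the degree.
--    Multiplication by t (mulT) satisfies t(ab) = (ta)b.
--  * Stirling numbers: (log(1+t))^m/m! = Σ_n S₁(n,m) tⁿ/n!.  Its derivative is
--    (1+t)⁻¹ (log(1+t))^{m-1}/(m-1)!, so multiplying by 1+t gives the
--    recurrence of S₁.
--  * Cancellation: a series d with invertible constant term is cancellable.
-- Since (1+λlog(1+t))^{0/λ} = 1, the generating function of Ch_{n,λ}(x) is
-- that of Ch_{n,λ} times (1+λlog(1+t))^{x/λ} = Σ_m (x)_{m,λ} (log(1+t))^m/m!: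
-- both sides become 2(1+λlog(1+t))^{x/λ} after multiplication by the
-- denominator, which cancels because 2 is invertible.  Expanding the product
-- gives the theorem.

open import Defs
open import Level using (Level)
open import Algebra.Bundles using (CommutativeRing)
open import Data.Nat using (ℕ; _∸_)
open import Data.Nat.Combinatorics using (_C_)
open import Data.Product using (Σ)
open import Relation.Nullary using (¬_)

open import Data.Product using (_,_)
import Data.Nat as ℕ
open import Data.Nat using (zero; suc; _≤_; z≤n)
open import Data.Nat.Properties using (≤-refl; m≤n⇒m≤1+n; n<1+n; +-∸-assoc; n∸n≡0)
open import Data.Nat.Combinatorics using (nCn≡1; nCk+nC[k+1]≡[n+1]C[k+1]; k>n⇒nCk≡0)
open import Data.Nat.Induction using (<-rec)
import Relation.Binary.PropositionalEquality as Eq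

module Series {c ℓ : Level} (R : CommutativeRing c ℓ) where
  open CommutativeRing R hiding (zero)
  open Changhee R
  open import Algebra.Properties.Ring ring using (x≈z//y; +-cancelˡ)
  open import Algebra.Solver.Ring.NaturalCoefficients.Default commutativeSemiring
  open import Relation.Binary.Reasoning.Setoid setoid

  sumTo-cong : ∀ {f g} n → (∀ k → k ≤ n → f k ≈ g k) → sumTo f n ≈ sumTo g n
  sumTo-cong zero    f≈g = f≈g 0 z≤n
  sumTo-cong (suc n) f≈g =
    +-cong (sumTo-cong n (λ k k≤n → f≈g k (m≤n⇒m≤1+n k≤n))) (f≈g (suc n) ≤-refl)

  sumTo-vanish : ∀ f n → (∀ k → k ≤ n → f k ≈ 0#) → sumTo f n ≈ 0#
  sumTo-vanish f n f≈0 =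
    trans (sumTo-cong n f≈0) (sumTo-zeros n)
    where
      sumTo-zeros : ∀ n → sumTo (λ _ → 0#) n ≈ 0#
      sumTo-zeros zero    = refl
      sumTo-zeros (suc n) = trans (+-identityʳ _) (sumTo-zeros n)

  sumTo-+ : ∀ f g n → sumTo (λ k → f k + g k) n ≈ sumTo f n + sumTo g n
  sumTo-+ f g zero    = refl
  sumTo-+ f g (suc n) = trans (+-cong (sumTo-+ f g n) refl)
    (solve 4 (λ a b x y → (a :+ b) :+ (x :+ y) := (a :+ x) :+ (b :+ y)) refl _ _ _ _)

  sumTo-*ˡ : ∀ s f n → s * sumTo f n ≈ sumTo (λ k → s * f k) n
  sumTo-*ˡ s f zero    = refl
  sumTo-*ˡ s f (suc n) = trans (distribˡ _ _ _) (+-cong (sumTo-*ˡ s f n) refl)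

  sumTo-*ʳ : ∀ s f n → sumTo f n * s ≈ sumTo (λ k → f k * s) n
  sumTo-*ʳ s f zero    = refl
  sumTo-*ʳ s f (suc n) = trans (distribʳ _ _ _) (+-cong (sumTo-*ʳ s f n) refl)

  sumTo-first : ∀ f n → sumTo f (suc n) ≈ f 0 + sumTo (λ k → f (suc k)) n
  sumTo-first f zero    = refl
  sumTo-first f (suc n) = trans (+-cong (sumTo-first f n) refl) (+-assoc _ _ _)

  natR-+ : ∀ m n → natR (m ℕ.+ n) ≈ natR m + natR n
  natR-+ zero    n = sym (+-identityˡ _)
  natR-+ (suc m) n = trans (+-cong refl (natR-+ m n)) (sym (+-assoc _ _ _))

  natR-pascal : ∀ n k → natR (suc n C suc k) ≈ natR (n C k) + natR (n C suc k)
  natR-pascal n k = trans (reflexive (Eq.cong natR (Eq.sym (nCk+nC[k+1]≡[n+1]C[k+1] n k))))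
                          (natR-+ (n C k) (n C suc k))

  natR-C-diagonal : ∀ n → natR (n C n) ≈ 1#
  natR-C-diagonal n rewrite nCn≡1 n = +-identityʳ 1#

  natR-C-beyond : ∀ n → natR (n C suc n) ≈ 0#
  natR-C-beyond n rewrite k>n⇒nCk≡0 (n<1+n n) = refl

  suc-∸ : ∀ {k n} → k ≤ n → suc n ∸ k Eq.≡ suc (n ∸ k)
  suc-∸ = +-∸-assoc 1

  Seq : Set c
  Seq = ℕ → Carrier

  infix 4 _≋_
  _≋_ : Seq → Seq → Set ℓ
  a ≋ b = ∀ n → a n ≈ b n

  ∂ : Seq → Seq
  ∂ a n = a (suc n)

  _⊕_ : Seq → Seq → Seq
  (a ⊕ b) n = a n + b n

  _·_ : Carrier → Seq → Seq
  (s · a) n = s * a n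

  δ : Seq
  δ zero    = 1#
  δ (suc _) = 0#

  -- multiplication by t:  t · Σ a_n tⁿ/n! = Σ (n+1) a_n t^{n+1}/(n+1)!
  mulT : Seq → Seq
  mulT a zero    = 0#
  mulT a (suc n) = natR (suc n) * a n

  -- The convolution ring

  ⊛-zero : ∀ a b → (a ⊛ b) 0 ≈ a 0 * b 0
  ⊛-zero a b = trans (*-cong (+-identityʳ 1#) refl) (*-identityˡ _)

  ⊛-last : ∀ a b n → (a ⊛ b) (suc n) ≈
    sumTo (λ k → natR (suc n C k) * (a k * b (suc n ∸ k))) n + a (suc n) * b 0
  ⊛-last a b n = +-cong refl (trans (*-cong (natR-C-diagonal (suc n))
    (*-cong refl (reflexive (Eq.cong b (n∸n≡0 n))))) (*-identityˡ _))

  ⊛-congˡ : ∀ {a a'} b → a ≋ a' → (a ⊛ b) ≋ (a' ⊛ b)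
  ⊛-congˡ b a≋a' n = sumTo-cong n (λ k _ → *-cong refl (*-cong (a≋a' k) refl))

  ⊛-congʳ : ∀ a {b b'} → b ≋ b' → (a ⊛ b) ≋ (a ⊛ b')
  ⊛-congʳ a b≋b' n = sumTo-cong n (λ k _ → *-cong refl (*-cong refl (b≋b' _)))

  ⊛-distribʳ : ∀ a a' b → ((a ⊕ a') ⊛ b) ≋ (a ⊛ b) ⊕ (a' ⊛ b)
  ⊛-distribʳ a a' b n = trans (sumTo-cong n (λ k _ →
      solve 4 (λ c x y z → c :* ((x :+ y) :* z) := c :* (x :* z) :+ c :* (y :* z)) refl _ _ _ _))
    (sumTo-+ _ _ n)

  ⊛-distribˡ : ∀ a b b' → (a ⊛ (b ⊕ b')) ≋ (a ⊛ b) ⊕ (a ⊛ b')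
  ⊛-distribˡ a b b' n = trans (sumTo-cong n (λ k _ →
      solve 4 (λ c x y z → c :* (x :* (y :+ z)) := c :* (x :* y) :+ c :* (x :* z)) refl _ _ _ _))
    (sumTo-+ _ _ n)

  ⊛-scaleʳ : ∀ s a b → (a ⊛ (s · b)) ≋ s · (a ⊛ b)
  ⊛-scaleʳ s a b n = trans (sumTo-cong n (λ k _ →
      solve 4 (λ s c x y → c :* (x :* (s :* y)) := s :* (c :* (x :* y))) refl _ _ _ _))
    (sym (sumTo-*ˡ s _ n))

  -- Leibniz rule (ab)' = a'b + ab'; on coefficients it is Pascal's rule
  ∂-leibniz : ∀ a b → ∂ (a ⊛ b) ≋ (∂ a ⊛ b) ⊕ (a ⊛ ∂ b)
  ∂-leibniz a b n = begin
      (a ⊛ b) (suc n)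
    ≈⟨ sumTo-first term n ⟩
      term 0 + sumTo (λ j → term (suc j)) n
    ≈⟨ +-cong refl (trans (sumTo-cong n (λ j _ → pascal j)) (sumTo-+ _ _ n)) ⟩
      term 0 + ((∂ a ⊛ b) n + sumTo (λ j → natR (n C suc j) * (a (suc j) * b (n ∸ j))) n)
    ≈⟨ solve 3 (λ x y z → x :+ (y :+ z) := y :+ (x :+ z)) refl _ _ _ ⟩
      (∂ a ⊛ b) n + (shifted 0 + sumTo (λ j → shifted (suc j)) n)
    ≈⟨ +-cong refl (sumTo-first shifted n) ⟨
      (∂ a ⊛ b) n + sumTo shifted (suc n)
    ≈⟨ +-cong refl (+-cong (sumTo-cong n (λ k k≤n → *-cong refl (*-cong refl
          (reflexive (Eq.cong b (suc-∸ k≤n)))))) beyond) ⟩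
      (∂ a ⊛ b) n + ((a ⊛ ∂ b) n + 0#)
    ≈⟨ +-cong refl (+-identityʳ _) ⟩
      (∂ a ⊛ b) n + (a ⊛ ∂ b) n
    ∎
    where
      term shifted : Seq
      term    k = natR (suc n C k) * (a k * b (suc n ∸ k))
      shifted k = natR (n C k) * (a k * b (suc n ∸ k))
      pascal : ∀ j → term (suc j) ≈
        natR (n C j) * (a (suc j) * b (n ∸ j)) + natR (n C suc j) * (a (suc j) * b (n ∸ j))
      pascal j = trans (*-cong (natR-pascal n j) refl) (distribʳ _ _ _)
      beyond : shifted (suc n) ≈ 0#
      beyond = trans (*-cong (natR-C-beyond n) refl) (zeroˡ _)

  -- Commutativity and associativity: equal constant terms, and by Leibniz the
  -- derivatives are instances of the same identity one degree lower.
  ⊛-comm : ∀ a b → (a ⊛ b) ≋ (b ⊛ a)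
  ⊛-comm a b zero    = trans (⊛-zero a b) (trans (*-comm _ _) (sym (⊛-zero b a)))
  ⊛-comm a b (suc n) = begin
      (a ⊛ b) (suc n)
    ≈⟨ ∂-leibniz a b n ⟩
      (∂ a ⊛ b) n + (a ⊛ ∂ b) n
    ≈⟨ +-cong (⊛-comm (∂ a) b n) (⊛-comm a (∂ b) n) ⟩
      (b ⊛ ∂ a) n + (∂ b ⊛ a) n
    ≈⟨ +-comm _ _ ⟩
      (∂ b ⊛ a) n + (b ⊛ ∂ a) n
    ≈⟨ ∂-leibniz b a n ⟨
      (b ⊛ a) (suc n)
    ∎

  ⊛-assoc : ∀ a b d → ((a ⊛ b) ⊛ d) ≋ (a ⊛ (b ⊛ d))
  ⊛-assoc a b d zero = trans (⊛-zero (a ⊛ b) d) (trans (*-cong (⊛-zero a b) refl)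
    (trans (*-assoc _ _ _) (trans (*-cong refl (sym (⊛-zero b d))) (sym (⊛-zero a (b ⊛ d))))))
  ⊛-assoc a b d (suc n) = begin
      ((a ⊛ b) ⊛ d) (suc n)
    ≈⟨ ∂-leibniz (a ⊛ b) d n ⟩
      (∂ (a ⊛ b) ⊛ d) n + ((a ⊛ b) ⊛ ∂ d) n
    ≈⟨ +-cong (trans (⊛-congˡ d (∂-leibniz a b) n) (⊛-distribʳ (∂ a ⊛ b) (a ⊛ ∂ b) d n)) refl ⟩
      (((∂ a ⊛ b) ⊛ d) n + ((a ⊛ ∂ b) ⊛ d) n) + ((a ⊛ b) ⊛ ∂ d) n
    ≈⟨ +-cong (+-cong (⊛-assoc (∂ a) b d n) (⊛-assoc a (∂ b) d n)) (⊛-assoc a b (∂ d) n) ⟩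
      ((∂ a ⊛ (b ⊛ d)) n + (a ⊛ (∂ b ⊛ d)) n) + (a ⊛ (b ⊛ ∂ d)) n
    ≈⟨ +-assoc _ _ _ ⟩
      (∂ a ⊛ (b ⊛ d)) n + ((a ⊛ (∂ b ⊛ d)) n + (a ⊛ (b ⊛ ∂ d)) n)
    ≈⟨ +-cong refl (trans (⊛-congʳ a (∂-leibniz b d) n)
                          (⊛-distribˡ a (∂ b ⊛ d) (b ⊛ ∂ d) n)) ⟨
      (∂ a ⊛ (b ⊛ d)) n + (a ⊛ ∂ (b ⊛ d)) n
    ≈⟨ ∂-leibniz a (b ⊛ d) n ⟨
      (a ⊛ (b ⊛ d)) (suc n)
    ∎

  ⊛-identityʳ : ∀ a → (a ⊛ δ) ≋ a
  ⊛-identityʳ a zero    = trans (⊛-zero a δ) (*-identityʳ _)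
  ⊛-identityʳ a (suc n) = trans (⊛-last a δ n)
    (trans (+-cong (sumTo-vanish _ n lower) (*-identityʳ _)) (+-identityˡ _))
    where
      lower : ∀ k → k ≤ n → natR (suc n C k) * (a k * δ (suc n ∸ k)) ≈ 0#
      lower k k≤n rewrite suc-∸ k≤n = trans (*-cong refl (zeroʳ _)) (zeroʳ _)

  ⊛-identityˡ : ∀ a → (δ ⊛ a) ≋ a
  ⊛-identityˡ a n = trans (⊛-comm δ a n) (⊛-identityʳ a n)

  ∂-mulT : ∀ a → ∂ (mulT a) ≋ a ⊕ mulT (∂ a)
  ∂-mulT a zero    = trans (*-cong (+-identityʳ 1#) refl) (trans (*-identityˡ _) (sym (+-identityʳ _)))
  ∂-mulT a (suc n) = trans (distribʳ _ _ _) (+-cong (*-identityˡ _) refl)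

  mulT-∂ : ∀ a → mulT (∂ a) ≋ λ n → natR n * a n
  mulT-∂ a zero    = sym (zeroˡ _)
  mulT-∂ a (suc n) = refl

  mulT-cong : ∀ {a b} → a ≋ b → mulT a ≋ mulT b
  mulT-cong a≋b zero    = refl
  mulT-cong a≋b (suc n) = *-cong refl (a≋b n)

  mulT-⊕ : ∀ a b → mulT (a ⊕ b) ≋ mulT a ⊕ mulT b
  mulT-⊕ a b zero    = sym (+-identityʳ 0#)
  mulT-⊕ a b (suc n) = distribˡ _ _ _

  -- t commutes with products; by Leibniz, inductively on the degree
  mulT-⊛ : ∀ a b → mulT (a ⊛ b) ≋ (mulT a ⊛ b)
  mulT-⊛ a b zero    = sym (trans (⊛-zero (mulT a) b) (zeroˡ _))
  mulT-⊛ a b (suc n) = sym (begin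
      (mulT a ⊛ b) (suc n)
    ≈⟨ ∂-leibniz (mulT a) b n ⟩
      (∂ (mulT a) ⊛ b) n + (mulT a ⊛ ∂ b) n
    ≈⟨ +-cong (trans (⊛-congˡ b (∂-mulT a) n) (⊛-distribʳ a (mulT (∂ a)) b n)) refl ⟩
      ((a ⊛ b) n + (mulT (∂ a) ⊛ b) n) + (mulT a ⊛ ∂ b) n
    ≈⟨ +-cong (+-cong refl (mulT-⊛ (∂ a) b n)) (mulT-⊛ a (∂ b) n) ⟨
      ((a ⊛ b) n + mulT (∂ a ⊛ b) n) + mulT (a ⊛ ∂ b) n
    ≈⟨ +-assoc _ _ _ ⟩
      (a ⊛ b) n + (mulT (∂ a ⊛ b) n + mulT (a ⊛ ∂ b) n)
    ≈⟨ +-cong refl (mulT-⊕ (∂ a ⊛ b) (a ⊛ ∂ b) n) ⟨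
      (a ⊛ b) n + mulT ((∂ a ⊛ b) ⊕ (a ⊛ ∂ b)) n
    ≈⟨ +-cong refl (mulT-cong (∂-leibniz a b) n) ⟨
      (a ⊛ b) n + mulT (∂ (a ⊛ b)) n
    ≈⟨ +-cong refl (mulT-∂ (a ⊛ b) n) ⟩
      (a ⊛ b) n + natR n * (a ⊛ b) n
    ≈⟨ trans (distribʳ _ _ _) (+-cong (*-identityˡ _) refl) ⟨
      mulT (a ⊛ b) (suc n)
    ∎)

  -- The logarithm and the Stirling numbers of the first kind

  logDeriv : Seq
  logDeriv = ∂ logSeries

  logDeriv-inverse : logDeriv ⊕ mulT logDeriv ≋ δ
  logDeriv-inverse zero    = +-identityʳ 1#
  logDeriv-inverse (suc n) = -‿inverseˡ _

  divide-by-1+t : ∀ a → (logDeriv ⊛ a) ⊕ mulT (logDeriv ⊛ a) ≋ a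
  divide-by-1+t a n = begin
      (logDeriv ⊛ a) n + mulT (logDeriv ⊛ a) n
    ≈⟨ +-cong refl (mulT-⊛ logDeriv a n) ⟩
      (logDeriv ⊛ a) n + (mulT logDeriv ⊛ a) n
    ≈⟨ ⊛-distribʳ logDeriv (mulT logDeriv) a n ⟨
      ((logDeriv ⊕ mulT logDeriv) ⊛ a) n
    ≈⟨ ⊛-congˡ a logDeriv-inverse n ⟩
      (δ ⊛ a) n
    ≈⟨ ⊛-identityˡ a n ⟩
      a n
    ∎

  -- With P_m = (log(1+t))^m/m!, P_{m+1}' = (1+t)⁻¹ P_m by definition of divPow;
  -- multiplying by 1+t gives the recurrence of the Stirling numbers S₁.
  logPower-recurrence : ∀ m n →
    divPow logSeries (suc m) (suc n) + natR n * divPow logSeries (suc m) n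
      ≈ divPow logSeries m n
  logPower-recurrence m n =
    trans (+-cong refl (sym (mulT-∂ (divPow logSeries (suc m)) n)))
          (divide-by-1+t (divPow logSeries m) n)

  logPower≈S₁ : ∀ n m → divPow logSeries m n ≈ S₁ n m
  logPower≈S₁ zero    zero    = refl
  logPower≈S₁ zero    (suc m) = refl
  logPower≈S₁ (suc n) zero    = refl
  logPower≈S₁ (suc n) (suc m) =
    trans (x≈z//y _ _ _ (logPower-recurrence m n))
          (+-cong (logPower≈S₁ n m) (-‿cong (*-cong refl (logPower≈S₁ n (suc m)))))

  fallD-at-zero : ∀ lam m → fallD lam 0# (suc m) ≈ 0#
  fallD-at-zero lam zero =
    trans (*-identityˡ _) (trans (+-cong refl (-‿cong (zeroˡ lam))) (-‿inverseʳ 0#))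
  fallD-at-zero lam (suc m) = trans (*-cong (fallD-at-zero lam m) refl) (zeroˡ _)

  degPowLog-at-zero : ∀ lam → degPowLog lam 0# ≋ δ
  degPowLog-at-zero lam zero    = *-identityˡ 1#
  degPowLog-at-zero lam (suc n) =
    trans (sumTo-first _ n)
      (trans (+-cong (*-identityˡ 0#) (sumTo-vanish _ n higher)) (+-identityˡ 0#))
    where
      higher : ∀ m → m ≤ n → fallD lam 0# (suc m) * divPow logSeries (suc m) (suc n) ≈ 0#
      higher m _ = trans (*-cong (fallD-at-zero lam m) refl) (zeroˡ _)

  degPowLog-⊛-expanded : ∀ lam x b n → (degPowLog lam x ⊛ b) n ≈
    sumTo (λ k → sumTo (λ m → natR (n C k) * fallD lam x m * S₁ k m * b (n ∸ k)) k) n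
  degPowLog-⊛-expanded lam x b n = sumTo-cong n (λ k _ → begin
      natR (n C k) * (sumTo (λ m → fallD lam x m * divPow logSeries m k) k * b (n ∸ k))
    ≈⟨ *-cong refl (sumTo-*ʳ _ _ k) ⟩
      natR (n C k) * sumTo (λ m → fallD lam x m * divPow logSeries m k * b (n ∸ k)) k
    ≈⟨ sumTo-*ˡ _ _ k ⟩
      sumTo (λ m → natR (n C k) * (fallD lam x m * divPow logSeries m k * b (n ∸ k))) k
    ≈⟨ sumTo-cong k (λ m _ → trans (*-cong refl (*-cong (*-cong refl (logPower≈S₁ k m)) refl))
         (solve 4 (λ c f s y → c :* (f :* s :* y) := c :* f :* s :* y) refl _ _ _ _)) ⟩
      sumTo (λ m → natR (n C k) * fallD lam x m * S₁ k m * b (n ∸ k)) k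
    ∎)

  -- Cancellation of a series with invertible constant term

  *-cancelʳ-unit : ∀ {u v} → u * v ≈ 1# → ∀ x y → x * u ≈ y * u → x ≈ y
  *-cancelʳ-unit {u} {v} uv≈1 x y xu≈yu = begin
      x             ≈⟨ *-identityʳ x ⟨
      x * 1#        ≈⟨ *-cong refl uv≈1 ⟨
      x * (u * v)   ≈⟨ *-assoc x u v ⟨
      (x * u) * v   ≈⟨ *-cong xu≈yu refl ⟩
      (y * u) * v   ≈⟨ *-assoc y u v ⟩
      y * (u * v)   ≈⟨ *-cong refl uv≈1 ⟩
      y * 1#        ≈⟨ *-identityʳ y ⟩
      y             ∎

  -- Strong induction on the degree: the top coefficient of G ⊛ d is G_n d_0
  -- plus terms involving only lower coefficients of G.
  ⊛-cancelʳ : ∀ {v} G H d → d 0 * v ≈ 1# → (G ⊛ d) ≋ (H ⊛ d) → G ≋ H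
  ⊛-cancelʳ G H d d₀v≈1 G⊛d≋H⊛d = <-rec (λ n → G n ≈ H n) agree
    where
      cancel = *-cancelʳ-unit d₀v≈1
      agree : ∀ n → (∀ {k} → k ℕ.< n → G k ≈ H k) → G n ≈ H n
      agree zero    _     =
        cancel _ _ (trans (sym (⊛-zero G d)) (trans (G⊛d≋H⊛d 0) (⊛-zero H d)))
      agree (suc n) lower = cancel _ _ (+-cancelˡ _ _ _ (begin
          sumTo (λ k → natR (suc n C k) * (H k * d (suc n ∸ k))) n + G (suc n) * d 0
        ≈⟨ +-cong (sumTo-cong n (λ k k≤n → *-cong refl (*-cong (lower (ℕ.s≤s k≤n)) refl))) refl ⟨
          sumTo (λ k → natR (suc n C k) * (G k * d (suc n ∸ k))) n + G (suc n) * d 0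
        ≈⟨ ⊛-last G d n ⟨
          (G ⊛ d) (suc n)
        ≈⟨ G⊛d≋H⊛d (suc n) ⟩
          (H ⊛ d) (suc n)
        ≈⟨ ⊛-last H d n ⟩
          sumTo (λ k → natR (suc n C k) * (H k * d (suc n ∸ k))) n + H (suc n) * d 0
        ∎))

  changhee-factorisation : ∀ {half} → (1# + 1#) * half ≈ 1# →
    ∀ lam Ch → IsChanghee2 lam Ch → ∀ x → Ch x ≋ (degPowLog lam x ⊛ Ch 0#)
  changhee-factorisation 2*half≈1 lam Ch isChanghee x =
    ⊛-cancelʳ (Ch x) (A ⊛ Ch 0#) d (trans (*-cong denom₀ refl) 2*half≈1) (λ n → begin
      (Ch x ⊛ d) n              ≈⟨ ⊛-comm (Ch x) d n ⟩
      (d ⊛ Ch x) n              ≈⟨ isChanghee x n ⟩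
      (2# · A) n                ≈⟨ *-cong refl (⊛-identityʳ A n) ⟨
      (2# · (A ⊛ δ)) n          ≈⟨ ⊛-scaleʳ 2# A δ n ⟨
      (A ⊛ (2# · δ)) n          ≈⟨ ⊛-congʳ A Ch₀⊛d≋2 n ⟨
      (A ⊛ (Ch 0# ⊛ d)) n       ≈⟨ ⊛-assoc A (Ch 0#) d n ⟨
      ((A ⊛ Ch 0#) ⊛ d) n       ∎)
    where
      2# : Carrier
      2# = 1# + 1#
      A d : Seq
      A = degPowLog lam x
      d = denom lam
      denom₀ : d 0 ≈ 2#
      denom₀ = +-cong refl (*-identityˡ 1#)
      Ch₀⊛d≋2 : (Ch 0# ⊛ d) ≋ (2# · δ)
      Ch₀⊛d≋2 k = trans (⊛-comm (Ch 0#) d k)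
                    (trans (isChanghee 0# k) (*-cong refl (degPowLog-at-zero lam k)))

theorem2p4 : {c ℓ : Level} (R : CommutativeRing c ℓ) →
    let open CommutativeRing R
        open Changhee R
    in (Σ Carrier λ half → (1# + 1#) * half ≈ 1#) →
       (lam : Carrier) → ¬ (lam ≈ 0#) →
       (Ch : Carrier → ℕ → Carrier) → IsChanghee2 lam Ch →
       (x : Carrier) (n : ℕ) →
       Ch x n ≈ sumTo (λ k → sumTo (λ m →
                  natR (n C k) * fallD lam x m * S₁ k m * Ch 0# (n ∸ k)) k) n
theorem2p4 R (half , 2*half≈1) lam _ Ch isChanghee x n =
  trans (changhee-factorisation 2*half≈1 lam Ch isChanghee x n)
        (degPowLog-⊛-expanded lam x (Ch 0#) n)
  where
    open CommutativeRing R using (trans; 0#)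
    open Series R
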